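{- For any string $S$, $|\mathsf{MAW}(S)|=O(\sigma\, e_{\min})$, where $\sigma$ is the alphabet size and $e_{\min}=\min\{r(S),l(S)\}$. This bound is tight: there is an infinite family of strings $S$ (the de Bruijn sequences of order $k$ over an alphabet of size $\sigma$) for which $|\mathsf{MAW}(S)|=\Omega(\sigma\, e_{\min})$.
   Context: Strings are over an alphabet $\Sigma$ of size $\sigma$. $\mathrm{occ}_S(w)$ is the number of occurrences of $w$ in $S$, with $\mathrm{occ}_S(\varepsilon)=|S|+1$; $\mathrm{Substr}(S)$ is the set of substrings of $S$. $\mathsf{MAW}(S)$ is the set of strings $aub$ with $a,b\in\Sigma$, $u\in\Sigma^*$, such that $\mathrm{occ}_S(aub)=0$, $\mathrm{occ}_S(au)\ge1$ and $\mathrm{occ}_S(ub)\ge1$. A substring $u$ of $S$ is left-maximal if $au,a'u\in\mathrm{Substr}(S)$ for some distinct characters $a\ne a'$ or $u$ is a prefix of $S$; right-maximal if $ub,ub'\in\mathrm{Substr}(S)$ for some distinct $b\ne b'$ or $u$ is a suffix of $S$. A maximal repeat is a left- and right-maximal substring occurring at least twice (including $\varepsilon$). $r(S)=\sum_{u}|\{b\in\Sigma: ub\in\mathrm{Substr}(S)\}|$ and $l(S)=\sum_u|\{a\in\Sigma: au\in\mathrm{Substr}(S)\}|$, both sums over all maximal repeats $u$ of $S$. -}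

module Defs where

open import Data.Nat using (ℕ; zero; suc; _+_; _*_; _∸_; _^_; _≤_; _<ᵇ_)
open import Data.Nat.Base using (_⊓_)
open import Data.Bool using (Bool; true; false; _∧_; _∨_; not; if_then_else_)
open import Data.Fin using (Fin)
open import Data.Fin.Properties using (_≟_)
open import Data.List using (List; []; _∷_; _++_; [_]; length; map; concatMap; allFin; upTo; reverse)
open import Data.Nat.ListAction using (sum)
open import Data.Bool.ListAction using (any)
open import Relation.Nullary using (does)
open import Relation.Binary.PropositionalEquality using (_≡_)

String : ℕ → Set
String σ = List (Fin σ)

count : {A : Set} → (A → Bool) → List A → ℕ
count p []       = 0
count p (x ∷ xs) = (if p x then 1 else 0) + count p xs

module _ {σ : ℕ} where

  _==_ : Fin σ → Fin σ → Bool
  a == b = does (a ≟ b)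

  isPrefix : String σ → String σ → Bool
  isPrefix []       _        = true
  isPrefix (_ ∷ _)  []       = false
  isPrefix (x ∷ w)  (y ∷ s)  = (x == y) ∧ isPrefix w s

  isSuffix : String σ → String σ → Bool
  isSuffix w s = isPrefix (reverse w) (reverse s)

  -- occ S w : number of occurrences of w in S, i.e. number of positions
  -- i ∈ {0,…,|S|} such that w is a prefix of S[i..]; so occ S ε = |S| + 1.
  occ : String σ → String σ → ℕ
  occ []       w = if isPrefix w [] then 1 else 0
  occ (x ∷ S)  w = (if isPrefix w (x ∷ S) then 1 else 0) + occ S w

  inSubstr : String σ → String σ → Bool
  inSubstr S w = 0 <ᵇ occ S w

  strings : ℕ → List (String σ)
  strings zero    = [] ∷ []
  strings (suc n) = concatMap (λ w → map (_∷ w) (allFin σ)) (strings n)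

  stringsUpTo : ℕ → List (String σ)
  stringsUpTo n = concatMap strings (upTo (suc n))

  leftMaximal : String σ → String σ → Bool
  leftMaximal S u =
    any (λ a → any (λ a′ → not (a == a′) ∧ inSubstr S (a ∷ u) ∧ inSubstr S (a′ ∷ u))
                   (allFin σ))
        (allFin σ)
    ∨ isPrefix u S

  rightMaximal : String σ → String σ → Bool
  rightMaximal S u =
    any (λ b → any (λ b′ → not (b == b′) ∧ inSubstr S (u ++ [ b ]) ∧ inSubstr S (u ++ [ b′ ]))
                   (allFin σ))
        (allFin σ)
    ∨ isSuffix u S

  -- u is a maximal repeat of S: left- and right-maximal and occ S u ≥ 2
  -- (ε included when it qualifies)
  isMaximalRepeat : String σ → String σ → Bool
  isMaximalRepeat S u = (1 <ᵇ occ S u) ∧ leftMaximal S u ∧ rightMaximal S u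

  -- the list of all maximal repeats of S, without repetition
  -- (every substring of S has length ≤ |S|)
  maximalRepeats : String σ → List (String σ)
  maximalRepeats S = go (stringsUpTo (length S))
    where
    go : List (String σ) → List (String σ)
    go []       = []
    go (u ∷ us) = if isMaximalRepeat S u then u ∷ go us else go us

  rOf : String σ → ℕ
  rOf S = sum (map (λ u → count (λ b → inSubstr S (u ++ [ b ])) (allFin σ)) (maximalRepeats S))

  lOf : String σ → ℕ
  lOf S = sum (map (λ u → count (λ a → inSubstr S (a ∷ u)) (allFin σ)) (maximalRepeats S))

  eMin : String σ → ℕ
  eMin S = rOf S ⊓ lOf S

  isMAW : String σ → Fin σ → String σ → Fin σ → Bool
  isMAW S a u b =
    not (inSubstr S (a ∷ u ++ [ b ])) ∧ inSubstr S (a ∷ u) ∧ inSubstr S (u ++ [ b ])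

  -- |MAW(S)|: the map (a , u , b) ↦ a u b is injective, so we count triples.
  -- If a u b ∈ MAW(S) then au ∈ Substr(S), so |u| < |S|; enumerating u of
  -- length ≤ |S| is therefore exhaustive.
  numMAW : String σ → ℕ
  numMAW S =
    sum (map (λ a → sum (map (λ u → count (λ b → isMAW S a u b) (allFin σ))
                             (stringsUpTo (length S))))
             (allFin σ))

  -- S is a (linear) de Bruijn sequence of order k over Fin σ:
  -- |S| = σ^k + k − 1 and every string of length k occurs exactly once in S.
  IsDeBruijn : ℕ → String σ → Set
  IsDeBruijn k S =
    (length S ≡ σ ^ k + k ∸ 1) × ((w : String σ) → length w ≡ k → occ S w ≡ 1)
    where open import Data.Product using (_×_)

{-# OPTIONS --safe #-}
module Submission where

open import Defs
open import Data.Nat using (ℕ; suc; _*_; _≤_)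
open import Data.Fin using (Fin)
open import Data.List using (List)
open import Data.Product using (Σ; _×_; _,_)

open import Data.Bool using (Bool; true; false; if_then_else_; T; not; _∧_)
open import Data.Bool.ListAction using (any)
open import Data.Bool.Properties using (∧-identityʳ; ∧-zeroʳ; T-≡; T-∧; T-∨)
open import Data.Empty using (⊥; ⊥-elim)
open import Data.Fin using (zero; suc)
open import Data.Fin.Properties using (_≟_; any?)
open import Data.List
  using ([]; _∷_; [_]; _++_; map; concat; concatMap; allFin; upTo; applyUpTo; length; reverse;
         take; drop; replicate; initLast; _∷ʳ′_)
open import Data.List.Membership.Propositional using (_∈_; lose)
open import Data.List.Membership.Propositional.Properties using (∈-allFin; ∈-upTo⁺)
open import Data.List.Properties
  using (map-++; map-tabulate; length-tabulate; upTo-∷ʳ; ++-assoc; ++-identityʳ; reverse-++;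
         length-++; length-take; length-drop; length-replicate; take++drop≡id; ∷ʳ-injective)
open import Data.List.Relation.Unary.Any using (here; there)
open import Data.List.Relation.Unary.Any.Properties using (any⁺)
open import Data.Nat hiding (_≟_)
open import Data.Nat.ListAction using (sum)
open import Data.Nat.ListAction.Properties using (sum-++)
open import Data.Nat.Properties hiding (_≟_)
open import Data.Nat.Properties using () renaming (_≟_ to _≟ℕ_)
open import Data.Nat.Solver using (module +-*-Solver)
open import Data.Product using (∃-syntax; proj₁; proj₂)
open import Data.Sum using (_⊎_; inj₁; inj₂)
open import Function using (_∘_; id)
open import Function.Bundles using (module Equivalence)
open import Relation.Binary.PropositionalEquality hiding ([_])
open import Relation.Nullary using (¬_; Dec; yes; no)
open import Relation.Nullary.Decidable using (dec-true; dec-false; ¬?; _×-dec_)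
open import Algebra.Properties.CommutativeSemigroup +-commutativeSemigroup
  using () renaming (interchange to +-interchange; xy∙z≈xz∙y to +-swapʳ)
open import Algebra.Properties.CommutativeSemigroup *-commutativeSemigroup using (x∙yz≈y∙xz)
open Equivalence using (to; from)

-- If aub is a minimal absent word of S then u is a maximal repeat: ub occurs, but not after a,
-- so it occurs at the start of S or after some a′ ≠ a, and dually au occurs at the end of S or
-- before some b′ ≠ b; either way u occurs at least twice. For a fixed middle u there are at most
-- σ letters a and r_u letters b with ub a substring (dually l_u letters a), hence |MAW(S)| is at
-- most σ·r(S) and at most σ·l(S).
--
-- In a de Bruijn sequence of order k every string of length k occurs exactly once, so maximal
-- repeats are shorter than k and r(S) ≤ σ + σ² + ⋯ + σᵏ ≤ 2σᵏ. Of the σᵏ⁺¹ strings aub with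
-- |u| = k − 1, au and ub always occur, and at most ∑ᵤ occ(u) = σᵏ + 1 of them occur, so
-- |MAW(S)| ≥ σᵏ⁺¹ − σᵏ − 1 and σ·e_min(S) ≤ 4·|MAW(S)|.
--
-- De Bruijn sequences exist by the greedy construction that starts with 0ᵏ⁻¹ and appends a
-- letter c ≠ 0 completing a new window of length k whenever possible, and 0 otherwise. Counting
-- the occurrences of a window v of length k − 1 by the letter before and by the letter after
-- shows that the construction can only get stuck at the initial window v = 0ᵏ⁻¹. Since 0 is
-- always tried last, a missing extension of a window au gives one of u0, and k − 1 such steps
-- from any window reach v. So when the construction is stuck all σᵏ windows occur already, and
-- the length of the sequence shows that it is complete.

-- Sums of natural numbers

𝟙 : Bool → ℕ
𝟙 b = if b then 1 else 0

𝟙≤1 : ∀ b → 𝟙 b ≤ 1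
𝟙≤1 true  = ≤-refl
𝟙≤1 false = z≤n

𝟙-¬T : ∀ {b} → ¬ T b → 𝟙 b ≡ 0
𝟙-¬T {false} _  = refl
𝟙-¬T {true}  ¬b = ⊥-elim (¬b _)

𝟙-mono : ∀ {b b′} → (T b → T b′) → 𝟙 b ≤ 𝟙 b′
𝟙-mono {false}         _    = z≤n
𝟙-mono {true}  {true}  _    = ≤-refl
𝟙-mono {true}  {false} b⇒b′ = ⊥-elim (b⇒b′ _)

𝟙-≤-* : ∀ {b c d} → (T b → T c × T d) → 𝟙 b ≤ 𝟙 c * 𝟙 d
𝟙-≤-* {false}                 _     = z≤n
𝟙-≤-* {true}  {true}  {true}  _     = ≤-refl
𝟙-≤-* {true}  {false}         b⇒c×d = ⊥-elim (proj₁ (b⇒c×d _))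
𝟙-≤-* {true}  {true}  {false} b⇒c×d = ⊥-elim (proj₂ (b⇒c×d _))

𝟙*≤ : ∀ b n → 𝟙 b * n ≤ n
𝟙*≤ true  n = ≤-reflexive (+-identityʳ n)
𝟙*≤ false n = z≤n

≤ᵇ-<ᵇ-suc : ∀ m n → (m ≤ᵇ n) ≡ (m <ᵇ suc n)
≤ᵇ-<ᵇ-suc zero    n = refl
≤ᵇ-<ᵇ-suc (suc m) n = refl

∑ : {A : Set} → List A → (A → ℕ) → ℕ
∑ xs f = sum (map f xs)

module _ {A : Set} where

  ∑-++ : ∀ xs ys (f : A → ℕ) → ∑ (xs ++ ys) f ≡ ∑ xs f + ∑ ys f
  ∑-++ xs ys f = trans (cong sum (map-++ f xs ys)) (sum-++ (map f xs) (map f ys))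

  ∑-+ : ∀ xs (f g : A → ℕ) → ∑ xs (λ x → f x + g x) ≡ ∑ xs f + ∑ xs g
  ∑-+ []       f g = refl
  ∑-+ (x ∷ xs) f g = trans (cong (f x + g x +_) (∑-+ xs f g)) (+-interchange (f x) (g x) _ _)

  ∑-mono-≤ : ∀ xs {f g : A → ℕ} → (∀ x → f x ≤ g x) → ∑ xs f ≤ ∑ xs g
  ∑-mono-≤ []       f≤g = z≤n
  ∑-mono-≤ (x ∷ xs) f≤g = +-mono-≤ (f≤g x) (∑-mono-≤ xs f≤g)

  ∑-cong : ∀ xs {f g : A → ℕ} → (∀ x → f x ≡ g x) → ∑ xs f ≡ ∑ xs g
  ∑-cong []       f≡g = refl
  ∑-cong (x ∷ xs) f≡g = cong₂ _+_ (f≡g x) (∑-cong xs f≡g)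

  ∑-const : ∀ xs c → ∑ {A} xs (λ _ → c) ≡ length xs * c
  ∑-const []       c = refl
  ∑-const (x ∷ xs) c = cong (c +_) (∑-const xs c)

  ∑-zero : ∀ xs {f : A → ℕ} → (∀ x → f x ≡ 0) → ∑ xs f ≡ 0
  ∑-zero xs f≡0 = trans (∑-cong xs f≡0) (trans (∑-const xs 0) (*-zeroʳ (length xs)))

  ∑-*ˡ : ∀ xs c (f : A → ℕ) → ∑ xs (λ x → c * f x) ≡ c * ∑ xs f
  ∑-*ˡ []       c f = sym (*-zeroʳ c)
  ∑-*ˡ (x ∷ xs) c f = trans (cong (c * f x +_) (∑-*ˡ xs c f)) (sym (*-distribˡ-+ c (f x) _))

  ∑-map : {B : Set} (xs : List B) (h : B → A) (f : A → ℕ) → ∑ (map h xs) f ≡ ∑ xs (f ∘ h)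
  ∑-map []       h f = refl
  ∑-map (x ∷ xs) h f = cong (f (h x) +_) (∑-map xs h f)

  ∑-concatMap : {B : Set} (xs : List B) (g : B → List A) (f : A → ℕ) →
                ∑ (concatMap g xs) f ≡ ∑ xs (λ x → ∑ (g x) f)
  ∑-concatMap []       g f = refl
  ∑-concatMap (x ∷ xs) g f =
    trans (∑-++ (g x) (concatMap g xs) f) (cong (∑ (g x) f +_) (∑-concatMap xs g f))

  ∑-∈ : ∀ {x xs} (f : A → ℕ) → x ∈ xs → f x ≤ ∑ xs f
  ∑-∈               f (here refl) = m≤m+n _ _
  ∑-∈ {xs = y ∷ _}  f (there x∈xs) = ≤-trans (∑-∈ f x∈xs) (m≤n+m _ (f y))

  ∑-pos : ∀ xs (f : A → ℕ) → 0 < ∑ xs f → ∃[ x ] 0 < f x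
  ∑-pos (x ∷ xs) f 0<∑ with f x in fx≡
  ... | suc _ = x , subst (0 <_) (sym fx≡) z<s
  ... | zero  = ∑-pos xs f 0<∑

∑-comm : {A B : Set} (xs : List A) (ys : List B) (f : A → B → ℕ) →
         ∑ xs (λ x → ∑ ys (f x)) ≡ ∑ ys (λ y → ∑ xs (λ x → f x y))
∑-comm []       ys f = sym (∑-zero ys (λ _ → refl))
∑-comm (x ∷ xs) ys f = trans (cong (∑ ys (f x) +_) (∑-comm xs ys f)) (sym (∑-+ ys (f x) _))

count≡∑ : {A : Set} (p : A → Bool) (xs : List A) → count p xs ≡ ∑ xs (𝟙 ∘ p)
count≡∑ p []       = refl
count≡∑ p (x ∷ xs) = cong (𝟙 (p x) +_) (count≡∑ p xs)

∑-upTo-suc : ∀ m (h : ℕ → ℕ) → ∑ (upTo (suc m)) h ≡ ∑ (upTo m) h + h m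
∑-upTo-suc m h = begin
  ∑ (upTo (suc m)) h         ≡⟨ cong (λ js → ∑ js h) (upTo-∷ʳ m) ⟨
  ∑ (upTo m ++ [ m ]) h      ≡⟨ ∑-++ (upTo m) [ m ] h ⟩
  ∑ (upTo m) h + (h m + 0)   ≡⟨ cong (∑ (upTo m) h +_) (+-identityʳ (h m)) ⟩
  ∑ (upTo m) h + h m         ∎
  where open ≡-Reasoning

∑-upTo-mono : ∀ {m n} (h : ℕ → ℕ) → m ≤ n → ∑ (upTo m) h ≤ ∑ (upTo n) h
∑-upTo-mono {n = zero}  h z≤n = ≤-refl
∑-upTo-mono {m} {suc n} h m≤1+n with m≤n⇒m<n∨m≡n m≤1+n
... | inj₂ refl  = ≤-refl
... | inj₁ m<1+n = begin
  ∑ (upTo m) h          ≤⟨ ∑-upTo-mono h (s≤s⁻¹ m<1+n) ⟩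
  ∑ (upTo n) h          ≤⟨ m≤m+n _ (h n) ⟩
  ∑ (upTo n) h + h n    ≡⟨ ∑-upTo-suc n h ⟨
  ∑ (upTo (suc n)) h    ∎
  where open ≤-Reasoning

∑-upTo-below : ∀ k m (h : ℕ → ℕ) → ∑ (upTo m) (λ j → 𝟙 (j <ᵇ k) * h j) ≤ ∑ (upTo k) h
∑-upTo-below k zero    h = z≤n
∑-upTo-below k (suc m) h with m <? k
... | yes m<k = ≤-trans (∑-mono-≤ (upTo (suc m)) (λ j → 𝟙*≤ (j <ᵇ k) (h j))) (∑-upTo-mono h m<k)
... | no  m≮k = begin
  ∑ (upTo (suc m)) below               ≡⟨ ∑-upTo-suc m below ⟩
  ∑ (upTo m) below + 𝟙 (m <ᵇ k) * h m  ≡⟨ cong (λ n → ∑ (upTo m) below + n * h m) 𝟙[m<k]≡0 ⟩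
  ∑ (upTo m) below + 0                 ≡⟨ +-identityʳ _ ⟩
  ∑ (upTo m) below                     ≤⟨ ∑-upTo-below k m h ⟩
  ∑ (upTo k) h                         ∎
  where
  open ≤-Reasoning
  below = λ j → 𝟙 (j <ᵇ k) * h j
  𝟙[m<k]≡0 = 𝟙-¬T (m≮k ∘ <ᵇ⇒< m k)

∑-allFin-suc : ∀ {n} (f : Fin (suc n) → ℕ) →
               ∑ (allFin (suc n)) f ≡ f zero + ∑ (allFin n) (f ∘ suc)
∑-allFin-suc f =
  cong (λ xs → f zero + sum xs) (trans (map-tabulate suc f) (sym (map-tabulate id (f ∘ suc))))

∑-allFin-const : ∀ n c → ∑ (allFin n) (λ _ → c) ≡ n * c
∑-allFin-const n c = trans (∑-const (allFin n) c) (cong (_* c) (length-tabulate {n = n} id))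

∑-allFin-pair : ∀ {n} (f : Fin n → ℕ) {a a′} → a ≢ a′ → f a + f a′ ≤ ∑ (allFin n) f
∑-allFin-pair {suc n} f {a} {a′} a≢a′ = ≤-trans (pair a a′ a≢a′) (≤-reflexive (sym (∑-allFin-suc f)))
  where
  rest = ∑ (allFin n) (f ∘ suc)
  pair : ∀ a a′ → a ≢ a′ → f a + f a′ ≤ f zero + rest
  pair zero    zero     0≢0  = ⊥-elim (0≢0 refl)
  pair zero    (suc a′) _    = +-monoʳ-≤ (f zero) (∑-∈ (f ∘ suc) (∈-allFin a′))
  pair (suc a) zero     _    =
    ≤-trans (≤-reflexive (+-comm (f (suc a)) (f zero))) (+-monoʳ-≤ (f zero) (∑-∈ (f ∘ suc) (∈-allFin a)))
  pair (suc a) (suc a′) a≢a′ = ≤-trans (∑-allFin-pair (f ∘ suc) (a≢a′ ∘ cong suc)) (m≤n+m rest (f zero))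

∑-allFin-≤ : ∀ {n} (f : Fin n → ℕ) → (∀ b → f b ≤ 1) → ∑ (allFin n) f ≤ n
∑-allFin-≤ {n} f f≤1 =
  ≤-trans (∑-mono-≤ (allFin n) f≤1) (≤-reflexive (trans (∑-allFin-const n 1) (*-identityʳ n)))

∑-allFin-≥ : ∀ {n} (f : Fin n → ℕ) → (∀ b → 1 ≤ f b) → n ≤ ∑ (allFin n) f
∑-allFin-≥ {n} f 1≤f =
  ≤-trans (≤-reflexive (sym (trans (∑-allFin-const n 1) (*-identityʳ n)))) (∑-mono-≤ (allFin n) 1≤f)

∑-allFin-< : ∀ {n} (f : Fin n → ℕ) → (∀ b → f b ≤ 1) → ∀ a → f a ≡ 0 → ∑ (allFin n) f < n
∑-allFin-< {suc n} f f≤1 a fa≡0 = subst (_< suc n) (sym (∑-allFin-suc f)) (split a fa≡0)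
  where
  split : ∀ a → f a ≡ 0 → f zero + ∑ (allFin n) (f ∘ suc) < suc n
  split zero    f0≡0 = +-mono-<-≤ (subst (_< 1) (sym f0≡0) z<s) (∑-allFin-≤ (f ∘ suc) (f≤1 ∘ suc))
  split (suc a) fa≡0 = +-mono-≤-< (f≤1 zero) (∑-allFin-< (f ∘ suc) (f≤1 ∘ suc) a fa≡0)

∑-allFin-<⇒zero : ∀ {n} (f : Fin n → ℕ) → ∑ (allFin n) f < n → ∃[ c ] f c ≡ 0
∑-allFin-<⇒zero {suc n} f ∑<1+n with f zero in f0≡ | subst (_< suc n) (∑-allFin-suc f) ∑<1+n
... | zero  | _        = zero , f0≡
... | suc x | x+rest<n with ∑-allFin-<⇒zero (f ∘ suc) (≤-trans (s≤s (m≤n+m _ x)) (s≤s⁻¹ x+rest<n))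
... | c , fc≡0 = suc c , fc≡0

∑-allFin-== : ∀ {n} (y : Fin n) → ∑ (allFin n) (λ c → 𝟙 (c == y)) ≡ 1
∑-allFin-== {suc n} zero    =
  trans (∑-allFin-suc {n} (λ c → 𝟙 (c == zero))) (cong suc (∑-zero (allFin n) (λ _ → refl)))
∑-allFin-== {suc n} (suc y) = trans (∑-allFin-suc {n} (λ c → 𝟙 (c == suc y))) (∑-allFin-== y)

∑-allFin-==-∧ : ∀ {n} (y : Fin n) b → ∑ (allFin n) (λ c → 𝟙 ((c == y) ∧ b)) ≡ 𝟙 b
∑-allFin-==-∧ {n} y true  =
  trans (∑-cong (allFin n) (λ c → cong 𝟙 (∧-identityʳ (c == y)))) (∑-allFin-== y)
∑-allFin-==-∧ {n} y false = ∑-zero (allFin n) (λ c → cong 𝟙 (∧-zeroʳ (c == y)))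

-- Strings and occurrences

length-∷ʳ : ∀ {A : Set} (xs : List A) x → length (xs ++ [ x ]) ≡ suc (length xs)
length-∷ʳ xs x = trans (length-++ xs) (+-comm (length xs) 1)

replicate-∷ʳ : ∀ {A : Set} n (x : A) → replicate n x ++ [ x ] ≡ replicate (suc n) x
replicate-∷ʳ zero    x = refl
replicate-∷ʳ (suc n) x = cong (x ∷_) (replicate-∷ʳ n x)

module _ {σ : ℕ} where

  ==-refl : (a : Fin σ) → (a == a) ≡ true
  ==-refl a = dec-true (a ≟ a) refl

  isPrefix-++ : (w v : String σ) → T (isPrefix w (w ++ v))
  isPrefix-++ []      v = _
  isPrefix-++ (a ∷ w) v rewrite ==-refl a = isPrefix-++ w v

  isPrefix-refl : (w : String σ) → T (isPrefix w w)
  isPrefix-refl w = subst (T ∘ isPrefix w) (++-identityʳ w) (isPrefix-++ w [])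

  isPrefix-++⁻ : (w v t : String σ) → T (isPrefix (w ++ v) t) → T (isPrefix w t)
  isPrefix-++⁻ []      v t       _ = _
  isPrefix-++⁻ (a ∷ w) v (y ∷ t) h with a == y
  ... | true = isPrefix-++⁻ w v t h

  isPrefix-++⁺ : (w t v : String σ) → T (isPrefix w t) → T (isPrefix w (t ++ v))
  isPrefix-++⁺ []      t       v _ = _
  isPrefix-++⁺ (a ∷ w) (y ∷ t) v h with a == y
  ... | true = isPrefix-++⁺ w t v h

  isPrefix-length : (w t : String σ) → T (isPrefix w t) → length w ≤ length t
  isPrefix-length []      t       _ = z≤n
  isPrefix-length (a ∷ w) (y ∷ t) h with a == y
  ... | true = s≤s (isPrefix-length w t h)

  isPrefix-unique : (u s x : String σ) → T (isPrefix u x) → T (isPrefix s x) →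
                    length u ≡ length s → u ≡ s
  isPrefix-unique []      []      x       _  _  _     = refl
  isPrefix-unique (a ∷ u) (b ∷ s) (y ∷ x) hu hs |u|≡|s| with a ≟ y | b ≟ y
  ... | yes refl | yes refl = cong (a ∷_) (isPrefix-unique u s x hu hs (suc-injective |u|≡|s|))

  isSuffix-++ : (t u : String σ) → T (isSuffix u (t ++ u))
  isSuffix-++ t u rewrite reverse-++ t u = isPrefix-++ (reverse u) (reverse t)

  infix 4 _==ˢ_
  _==ˢ_ : String σ → String σ → Bool
  []      ==ˢ []      = true
  (a ∷ u) ==ˢ (b ∷ t) = (a == b) ∧ (u ==ˢ t)
  _       ==ˢ _       = false

  ==ˢ-refl : (u : String σ) → T (u ==ˢ u)
  ==ˢ-refl []      = _
  ==ˢ-refl (a ∷ u) rewrite ==-refl a = ==ˢ-refl u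

  ==ˢ-sound : (u t : String σ) → T (u ==ˢ t) → u ≡ t
  ==ˢ-sound []      []      _ = refl
  ==ˢ-sound (a ∷ u) (b ∷ t) h with a ≟ b
  ... | yes refl = cong (a ∷_) (==ˢ-sound u t h)

  ==ˢ-length : (u t : String σ) → length u ≢ length t → ¬ T (u ==ˢ t)
  ==ˢ-length u t |u|≢|t| = |u|≢|t| ∘ cong length ∘ ==ˢ-sound u t

  occAtEnd : String σ → String σ → ℕ
  occAtEnd []      u = 𝟙 (u ==ˢ [])
  occAtEnd (y ∷ x) u = 𝟙 (u ==ˢ y ∷ x) + occAtEnd x u

  occAtEnd-suffix : (x w : String σ) → 0 < occAtEnd x w → ∃[ t ] x ≡ t ++ w
  occAtEnd-suffix []      w h with w ==ˢ [] in eq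
  ... | true = [] , sym (==ˢ-sound w [] (subst T (sym eq) _))
  occAtEnd-suffix (y ∷ x) w h with w ==ˢ y ∷ x in eq
  ... | true  = [] , sym (==ˢ-sound w (y ∷ x) (subst T (sym eq) _))
  ... | false with occAtEnd-suffix x w h
  ... | t , x≡t++w = y ∷ t , cong (y ∷_) x≡t++w

  occAtEnd-long : (x w : String σ) → length x < length w → occAtEnd x w ≡ 0
  occAtEnd-long []      w |x|<|w| = 𝟙-¬T (==ˢ-length w [] (>⇒≢ |x|<|w|))
  occAtEnd-long (y ∷ x) w |x|<|w| =
    cong₂ _+_ (𝟙-¬T (==ˢ-length w (y ∷ x) (>⇒≢ |x|<|w|)))
              (occAtEnd-long x w (<-trans (n<1+n _) |x|<|w|))

  occAtEnd-++ : (t s w : String σ) → length w ≡ length s → occAtEnd (t ++ s) w ≡ 𝟙 (w ==ˢ s)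
  occAtEnd-++ []      []      w _       = refl
  occAtEnd-++ []      (y ∷ s) w |w|≡|s| =
    trans (cong (𝟙 (w ==ˢ y ∷ s) +_) (occAtEnd-long s w (≤-reflexive (sym |w|≡|s|)))) (+-identityʳ _)
  occAtEnd-++ (y ∷ t) s       w |w|≡|s| =
    trans (cong (_+ occAtEnd (t ++ s) w) (𝟙-¬T (==ˢ-length w (y ∷ t ++ s) |w|≢|yts|)))
          (occAtEnd-++ t s w |w|≡|s|)
    where
    |w|≢|yts| : length w ≢ length (y ∷ t ++ s)
    |w|≢|yts| |w|≡|yts| = <⇒≢ (s≤s (m≤n+m (length s) (length t)))
      (trans (sym |w|≡|s|) (trans |w|≡|yts| (cong suc (length-++ t))))

  isPrefix-right-extensions : (u t : String σ) →
    𝟙 (isPrefix u t) ≡ ∑ (allFin σ) (λ c → 𝟙 (isPrefix (u ++ [ c ]) t)) + 𝟙 (u ==ˢ t)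
  isPrefix-right-extensions []      []      = cong (_+ 1) (sym (∑-zero (allFin σ) (λ _ → refl)))
  isPrefix-right-extensions []      (y ∷ t) = sym (trans (+-identityʳ _) (∑-allFin-==-∧ y true))
  isPrefix-right-extensions (a ∷ u) []      = cong (_+ 0) (sym (∑-zero (allFin σ) (λ _ → refl)))
  isPrefix-right-extensions (a ∷ u) (y ∷ t) with a == y
  ... | true  = isPrefix-right-extensions u t
  ... | false = cong (_+ 0) (sym (∑-zero (allFin σ) (λ _ → refl)))

  isPrefix-∷ʳ : (w t : String σ) (c : Fin σ) →
    𝟙 (isPrefix w (t ++ [ c ])) ≡ 𝟙 (isPrefix w t) + 𝟙 (w ==ˢ t ++ [ c ])
  isPrefix-∷ʳ []          []      c = refl
  isPrefix-∷ʳ []          (_ ∷ _) c = refl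
  isPrefix-∷ʳ (a ∷ [])    []      c with a == c
  ... | true  = refl
  ... | false = refl
  isPrefix-∷ʳ (a ∷ _ ∷ _) []      c with a == c
  ... | true  = refl
  ... | false = refl
  isPrefix-∷ʳ (a ∷ w)     (y ∷ t) c with a == y
  ... | true  = isPrefix-∷ʳ w t c
  ... | false = refl

  occ-left-extensions : (x u : String σ) →
    occ x u ≡ 𝟙 (isPrefix u x) + ∑ (allFin σ) (λ a → occ x (a ∷ u))
  occ-left-extensions []      u =
    sym (trans (cong (𝟙 (isPrefix u []) +_) (∑-zero (allFin σ) (λ _ → refl))) (+-identityʳ _))
  occ-left-extensions (y ∷ x) u = begin
    first + occ x u
      ≡⟨ cong (first +_) (occ-left-extensions x u) ⟩
    first + (𝟙 (isPrefix u x) + later)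
      ≡⟨ cong (λ n → first + (n + later)) (∑-allFin-==-∧ y (isPrefix u x)) ⟨
    first + (∑ (allFin σ) (λ a → 𝟙 ((a == y) ∧ isPrefix u x)) + later)
      ≡⟨ cong (first +_) (∑-+ (allFin σ) _ _) ⟨
    first + ∑ (allFin σ) (λ a → occ (y ∷ x) (a ∷ u))
      ∎
    where
    open ≡-Reasoning
    first = 𝟙 (isPrefix u (y ∷ x))
    later = ∑ (allFin σ) (λ a → occ x (a ∷ u))

  occ-right-extensions : (x u : String σ) →
    occ x u ≡ ∑ (allFin σ) (λ c → occ x (u ++ [ c ])) + occAtEnd x u
  occ-right-extensions []      u = isPrefix-right-extensions u []
  occ-right-extensions (y ∷ x) u = begin
    𝟙 (isPrefix u (y ∷ x)) + occ x u
      ≡⟨ cong₂ _+_ (isPrefix-right-extensions u (y ∷ x)) (occ-right-extensions x u) ⟩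
    (now + 𝟙 (u ==ˢ y ∷ x)) + (later + occAtEnd x u)
      ≡⟨ +-interchange now (𝟙 (u ==ˢ y ∷ x)) later (occAtEnd x u) ⟩
    (now + later) + occAtEnd (y ∷ x) u
      ≡⟨ cong (_+ occAtEnd (y ∷ x) u) (∑-+ (allFin σ) _ _) ⟨
    ∑ (allFin σ) (λ c → occ (y ∷ x) (u ++ [ c ])) + occAtEnd (y ∷ x) u
      ∎
    where
    open ≡-Reasoning
    now   = ∑ (allFin σ) (λ c → 𝟙 (isPrefix (u ++ [ c ]) (y ∷ x)))
    later = ∑ (allFin σ) (λ c → occ x (u ++ [ c ]))

  occ-∷ʳ : (x w : String σ) (c : Fin σ) → occ (x ++ [ c ]) w ≡ occ x w + occAtEnd (x ++ [ c ]) w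
  occ-∷ʳ []      w c = begin
    𝟙 (isPrefix w [ c ]) + 𝟙 (isPrefix w [])
      ≡⟨ cong₂ _+_ (isPrefix-∷ʳ w [] c) (isPrefix-[] w) ⟩
    (𝟙 (isPrefix w []) + 𝟙 (w ==ˢ [ c ])) + 𝟙 (w ==ˢ [])
      ≡⟨ +-assoc (𝟙 (isPrefix w [])) _ _ ⟩
    𝟙 (isPrefix w []) + (𝟙 (w ==ˢ [ c ]) + 𝟙 (w ==ˢ []))
      ∎
    where
    open ≡-Reasoning
    isPrefix-[] : (w : String σ) → 𝟙 (isPrefix w []) ≡ 𝟙 (w ==ˢ [])
    isPrefix-[] []      = refl
    isPrefix-[] (_ ∷ _) = refl
  occ-∷ʳ (y ∷ x) w c = begin
    𝟙 (isPrefix w (y ∷ x ++ [ c ])) + occ (x ++ [ c ]) w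
      ≡⟨ cong₂ _+_ (isPrefix-∷ʳ w (y ∷ x) c) (occ-∷ʳ x w c) ⟩
    (𝟙 (isPrefix w (y ∷ x)) + 𝟙 (w ==ˢ y ∷ x ++ [ c ])) + (occ x w + occAtEnd (x ++ [ c ]) w)
      ≡⟨ +-interchange (𝟙 (isPrefix w (y ∷ x))) _ (occ x w) _ ⟩
    (𝟙 (isPrefix w (y ∷ x)) + occ x w) + (𝟙 (w ==ˢ y ∷ x ++ [ c ]) + occAtEnd (x ++ [ c ]) w)
      ∎
    where open ≡-Reasoning

  occ-++-≤ : (x w v : String σ) → occ x (w ++ v) ≤ occ x w
  occ-++-≤ []      w v = 𝟙-mono (isPrefix-++⁻ w v [])
  occ-++-≤ (y ∷ x) w v = +-mono-≤ (𝟙-mono (isPrefix-++⁻ w v (y ∷ x))) (occ-++-≤ x w v)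

  occ-∷-≤ : (x w : String σ) (a : Fin σ) → occ x (a ∷ w) ≤ occ x w
  occ-∷-≤ x w a = begin
    occ x (a ∷ w)                                           ≤⟨ ∑-∈ (λ a → occ x (a ∷ w)) (∈-allFin a) ⟩
    ∑ (allFin σ) (λ a → occ x (a ∷ w))                      ≤⟨ m≤n+m _ _ ⟩
    𝟙 (isPrefix w x) + ∑ (allFin σ) (λ a → occ x (a ∷ w))   ≡⟨ occ-left-extensions x w ⟨
    occ x w                                                 ∎
    where open ≤-Reasoning

  occ-long : (x w : String σ) → length x < length w → occ x w ≡ 0
  occ-long []      (_ ∷ _) _       = refl
  occ-long (y ∷ x) w       |x|<|w| =
    cong₂ _+_ (𝟙-¬T (<⇒≱ |x|<|w| ∘ isPrefix-length w (y ∷ x)))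
              (occ-long x w (<-trans (n<1+n _) |x|<|w|))

  ∑-strings-suc : ∀ m (f : String σ → ℕ) →
    ∑ (strings (suc m)) f ≡ ∑ (strings m) (λ w → ∑ (allFin σ) (λ c → f (c ∷ w)))
  ∑-strings-suc m f =
    trans (∑-concatMap (strings m) _ f) (∑-cong (strings m) (λ w → ∑-map (allFin σ) (_∷ w) f))

  ∑-strings-mono-≤ : ∀ m {f g : String σ → ℕ} → (∀ w → length w ≡ m → f w ≤ g w) →
                     ∑ (strings m) f ≤ ∑ (strings m) g
  ∑-strings-mono-≤ zero    f≤g = +-monoˡ-≤ 0 (f≤g [] refl)
  ∑-strings-mono-≤ (suc m) {f} {g} f≤g = begin
    ∑ (strings (suc m)) f                                 ≡⟨ ∑-strings-suc m f ⟩
    ∑ (strings m) (λ w → ∑ (allFin σ) (λ c → f (c ∷ w)))  ≤⟨ ∑-strings-mono-≤ m f≤g-∷ ⟩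
    ∑ (strings m) (λ w → ∑ (allFin σ) (λ c → g (c ∷ w)))  ≡⟨ ∑-strings-suc m g ⟨
    ∑ (strings (suc m)) g                                 ∎
    where
    open ≤-Reasoning
    f≤g-∷ : ∀ w → length w ≡ m → ∑ (allFin σ) (λ c → f (c ∷ w)) ≤ ∑ (allFin σ) (λ c → g (c ∷ w))
    f≤g-∷ w |w|≡m = ∑-mono-≤ (allFin σ) (λ c → f≤g (c ∷ w) (cong suc |w|≡m))

  ∑-strings-cong : ∀ m {f g : String σ → ℕ} → (∀ w → length w ≡ m → f w ≡ g w) →
                   ∑ (strings m) f ≡ ∑ (strings m) g
  ∑-strings-cong m f≡g = ≤-antisym (∑-strings-mono-≤ m (λ w l → ≤-reflexive (f≡g w l)))
                                   (∑-strings-mono-≤ m (λ w l → ≤-reflexive (sym (f≡g w l))))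

  ∑-strings-const : ∀ m c → ∑ (strings {σ} m) (λ _ → c) ≡ σ ^ m * c
  ∑-strings-const zero    c = trans (+-identityʳ c) (sym (*-identityˡ c))
  ∑-strings-const (suc m) c = begin
    ∑ (strings (suc m)) (λ _ → c)              ≡⟨ ∑-strings-suc m (λ _ → c) ⟩
    ∑ (strings m) (λ _ → ∑ (allFin σ) (λ _ → c)) ≡⟨ ∑-cong (strings m) (λ _ → ∑-allFin-const σ c) ⟩
    ∑ (strings m) (λ _ → σ * c)                ≡⟨ ∑-strings-const m (σ * c) ⟩
    σ ^ m * (σ * c)                            ≡⟨ *-assoc (σ ^ m) σ c ⟨
    σ ^ m * σ * c                              ≡⟨ cong (_* c) (*-comm (σ ^ m) σ) ⟩
    σ ^ suc m * c                              ∎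
    where open ≡-Reasoning

  ∑-strings-isPrefix : ∀ m (t : String σ) →
                       ∑ (strings m) (λ w → 𝟙 (isPrefix w t)) ≡ 𝟙 (m ≤ᵇ length t)
  ∑-strings-isPrefix zero    t       = refl
  ∑-strings-isPrefix (suc m) []      =
    trans (∑-strings-suc m _) (∑-zero (strings m) (λ w → ∑-zero (allFin σ) (λ c → refl)))
  ∑-strings-isPrefix (suc m) (y ∷ t) = begin
    ∑ (strings (suc m)) (λ w → 𝟙 (isPrefix w (y ∷ t)))
      ≡⟨ ∑-strings-suc m _ ⟩
    ∑ (strings m) (λ w → ∑ (allFin σ) (λ c → 𝟙 ((c == y) ∧ isPrefix w t)))
      ≡⟨ ∑-cong (strings m) (λ w → ∑-allFin-==-∧ y (isPrefix w t)) ⟩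
    ∑ (strings m) (λ w → 𝟙 (isPrefix w t))
      ≡⟨ ∑-strings-isPrefix m t ⟩
    𝟙 (m ≤ᵇ length t)
      ≡⟨ cong 𝟙 (≤ᵇ-<ᵇ-suc m (length t)) ⟩
    𝟙 (suc m ≤ᵇ length (y ∷ t))
      ∎
    where open ≡-Reasoning

  ∑-strings-occ : ∀ m (x : String σ) → ∑ (strings m) (occ x) ≡ suc (length x) ∸ m
  ∑-strings-occ zero    []      = refl
  ∑-strings-occ (suc m) []      = trans (∑-strings-isPrefix (suc m) []) (sym (0∸n≡0 m))
  ∑-strings-occ m       (y ∷ x) = begin
    ∑ (strings m) (occ (y ∷ x))
      ≡⟨ ∑-+ (strings m) (λ w → 𝟙 (isPrefix w (y ∷ x))) (occ x) ⟩
    ∑ (strings m) (λ w → 𝟙 (isPrefix w (y ∷ x))) + ∑ (strings m) (occ x)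
      ≡⟨ cong₂ _+_ (∑-strings-isPrefix m (y ∷ x)) (∑-strings-occ m x) ⟩
    𝟙 (m ≤ᵇ suc (length x)) + (suc (length x) ∸ m)
      ≡⟨ suc-∸ (suc (length x)) m ⟨
    suc (suc (length x)) ∸ m
      ∎
    where
    open ≡-Reasoning
    suc-∸ : ∀ n m → suc n ∸ m ≡ 𝟙 (m ≤ᵇ n) + (n ∸ m)
    suc-∸ n       zero    = refl
    suc-∸ zero    (suc m) = 0∸n≡0 m
    suc-∸ (suc n) (suc m) = trans (suc-∸ n m) (cong (λ b → 𝟙 b + (n ∸ m)) (≤ᵇ-<ᵇ-suc m n))

  ∑-strings-length : ∀ m (g : ℕ → ℕ) → ∑ (strings {σ} m) (g ∘ length) ≡ σ ^ m * g m
  ∑-strings-length m g =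
    trans (∑-strings-cong m (λ w |w|≡m → cong g |w|≡m)) (∑-strings-const m (g m))

  ∑-occ-two-sided-≤ : (x u : String σ) →
    ∑ (allFin σ) (λ a → ∑ (allFin σ) (λ b → occ x (a ∷ u ++ [ b ]))) ≤ occ x u
  ∑-occ-two-sided-≤ x u = begin
    ∑ (allFin σ) (λ a → ∑ (allFin σ) (λ b → occ x (a ∷ u ++ [ b ])))
      ≡⟨ ∑-comm (allFin σ) (allFin σ) (λ a b → occ x (a ∷ u ++ [ b ])) ⟩
    ∑ (allFin σ) (λ b → ∑ (allFin σ) (λ a → occ x (a ∷ u ++ [ b ])))
      ≤⟨ ∑-mono-≤ (allFin σ) (λ b →
           ≤-trans (m≤n+m _ _) (≤-reflexive (sym (occ-left-extensions x (u ++ [ b ]))))) ⟩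
    ∑ (allFin σ) (λ b → occ x (u ++ [ b ]))
      ≤⟨ ≤-trans (m≤m+n _ _) (≤-reflexive (sym (occ-right-extensions x u))) ⟩
    occ x u
      ∎
    where open ≤-Reasoning

  ∑-strings-≤1-exact : ∀ m (f : String σ → ℕ) → (∀ w → length w ≡ m → f w ≤ 1) →
    σ ^ m ≤ ∑ (strings m) f → ∀ w → length w ≡ m → f w ≡ 1
  ∑-strings-≤1-exact m f f≤1 σ^m≤∑ w |w|≡m with m≤n⇒m<n∨m≡n (f≤1 w |w|≡m)
  ... | inj₂ fw≡1 = fw≡1
  ... | inj₁ fw<1 = ⊥-elim (<-irrefl refl (begin-strict
    σ ^ m
      <⟨ m<m+n (σ ^ m) z<s ⟩
    σ ^ m + 1
      ≤⟨ +-mono-≤ σ^m≤∑ (≤-reflexive (sym indicator-w)) ⟩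
    ∑ (strings m) f + ∑ (strings m) (λ w′ → 𝟙 (isPrefix w′ w))
      ≡⟨ ∑-+ (strings m) f _ ⟨
    ∑ (strings m) (λ w′ → f w′ + 𝟙 (isPrefix w′ w))
      ≤⟨ ∑-strings-mono-≤ m pointwise ⟩
    ∑ (strings m) (λ _ → 1)
      ≡⟨ trans (∑-strings-const m 1) (*-identityʳ (σ ^ m)) ⟩
    σ ^ m
      ∎))
    where
    open ≤-Reasoning
    indicator-w : ∑ (strings m) (λ w′ → 𝟙 (isPrefix w′ w)) ≡ 1
    indicator-w = trans (∑-strings-isPrefix m w) (cong 𝟙 (to T-≡ (≤⇒≤ᵇ (≤-reflexive (sym |w|≡m)))))
    pointwise : ∀ w′ → length w′ ≡ m → f w′ + 𝟙 (isPrefix w′ w) ≤ 1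
    pointwise w′ |w′|≡m with isPrefix w′ w in w′⊑w
    ... | true  rewrite isPrefix-unique w′ w w (subst T (sym w′⊑w) _) (isPrefix-refl w)
                                        (trans |w′|≡m (sym |w|≡m))
                      | n<1⇒n≡0 fw<1 = ≤-refl
    ... | false = ≤-trans (≤-reflexive (+-identityʳ (f w′))) (f≤1 w′ |w′|≡m)

-- Maximal repeats and minimal absent words

module _ {X : Set} (p : X → Bool) where

  IsFilter : (List X → List X) → Set
  IsFilter g = g [] ≡ [] × (∀ u us → g (u ∷ us) ≡ (if p u then u ∷ g us else g us))

  ∑-filter : ∀ {g} → IsFilter g → ∀ us (f : X → ℕ) → ∑ (g us) f ≡ ∑ us (λ u → 𝟙 (p u) * f u)
  ∑-filter (g[]≡[] , _) [] f rewrite g[]≡[] = refl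
  ∑-filter isFilter@(_ , g∷≡) (u ∷ us) f rewrite g∷≡ u us with p u
  ... | true  = cong₂ _+_ (sym (+-identityʳ (f u))) (∑-filter isFilter us f)
  ... | false = ∑-filter isFilter us f

  filter-unfold : ∀ {g} → IsFilter g → ∀ u us →
    Σ (List X → List X) (λ g′ → IsFilter g′ × (if p u then u ∷ g us else g us) ≡ g′ (u ∷ us))
  filter-unfold {g} isFilter u us = g , isFilter , sym (proj₂ isFilter u us)

module _ {σ : ℕ} where

  -- `maximalRepeats` filters through a local function that cannot be named. Abstracting the tail
  -- of `stringsUpTo (length S)` (its head is ε) exposes that function applied to a variable, and
  -- unification then solves the filter of `filter-unfold`, which is created before the abstraction.
  maximalRepeats-filter : (S : String σ) →
    Σ (List (String σ) → List (String σ))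
      (λ g → IsFilter (isMaximalRepeat S) g × maximalRepeats S ≡ g (stringsUpTo (length S)))
  maximalRepeats-filter S
    with concat (map (strings {σ}) (applyUpTo suc (length S)))
       | filter-unfold (isMaximalRepeat S) (refl , λ _ _ → refl) []
  ... | us | unfold = unfold us

  ∑-maximalRepeats : (S : String σ) (f : String σ → ℕ) →
    ∑ (maximalRepeats S) f ≡ ∑ (stringsUpTo (length S)) (λ u → 𝟙 (isMaximalRepeat S u) * f u)
  ∑-maximalRepeats S f with maximalRepeats-filter S
  ... | g , isFilter , mr≡g =
    trans (cong (λ us → ∑ us f) mr≡g) (∑-filter (isMaximalRepeat S) isFilter _ f)

  isMAW-occ : (S : String σ) (a : Fin σ) (u : String σ) (b : Fin σ) → T (isMAW S a u b) →
    occ S (a ∷ u ++ [ b ]) ≡ 0 × 0 < occ S (a ∷ u) × 0 < occ S (u ++ [ b ])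
  isMAW-occ S a u b isMAW-aub with occ S (a ∷ u ++ [ b ]) | occ S (a ∷ u) | occ S (u ++ [ b ])
  ... | zero | suc _ | suc _ = refl , z<s , z<s

  any-distinct-pair : (P : Fin σ → Bool) {a a′ : Fin σ} → a ≢ a′ → T (P a) → T (P a′) →
    T (any (λ a → any (λ a′ → not (a == a′) ∧ P a ∧ P a′) (allFin σ)) (allFin σ))
  any-distinct-pair P {a} {a′} a≢a′ Pa Pa′ =
    any⁺ _ (lose (∈-allFin a) (any⁺ _ (lose (∈-allFin a′) (from T-∧ (a≠a′ , from T-∧ (Pa , Pa′))))))
    where
    a≠a′ : T (not (a == a′))
    a≠a′ rewrite dec-false (a ≟ a′) a≢a′ = _

  another-left-context : (S : String σ) (a : Fin σ) (u : String σ) (b : Fin σ) →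
    occ S (a ∷ u ++ [ b ]) ≡ 0 → 0 < occ S (u ++ [ b ]) →
    T (isPrefix u S) ⊎ ∃[ a′ ] a ≢ a′ × 0 < occ S (a′ ∷ u)
  another-left-context S a u b aub∉S ub∈S
    with isPrefix (u ++ [ b ]) S in ub-prefix | subst (0 <_) (occ-left-extensions S (u ++ [ b ])) ub∈S
  ... | true  | _           = inj₁ (isPrefix-++⁻ u [ b ] S (subst T (sym ub-prefix) _))
  ... | false | ub-preceded with ∑-pos (allFin σ) (λ a′ → occ S (a′ ∷ u ++ [ b ])) ub-preceded
  ... | a′ , a′ub∈S = inj₂ (a′ , a≢a′ , <-≤-trans a′ub∈S (occ-++-≤ S (a′ ∷ u) [ b ]))
    where
    a≢a′ : a ≢ a′
    a≢a′ refl = <⇒≢ a′ub∈S (sym aub∉S)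

  another-right-context : (S : String σ) (a : Fin σ) (u : String σ) (b : Fin σ) →
    occ S (a ∷ u ++ [ b ]) ≡ 0 → 0 < occ S (a ∷ u) →
    (∃[ t ] S ≡ t ++ a ∷ u) ⊎ ∃[ b′ ] b ≢ b′ × 0 < occ S (u ++ [ b′ ])
  another-right-context S a u b aub∉S au∈S
    with occAtEnd S (a ∷ u) in au-atEnd | subst (0 <_) (occ-right-extensions S (a ∷ u)) au∈S
  ... | suc _ | _           = inj₁ (occAtEnd-suffix S (a ∷ u) (subst (0 <_) (sym au-atEnd) z<s))
  ... | zero  | au-followed with ∑-pos (allFin σ) (λ b′ → occ S (a ∷ u ++ [ b′ ]))
                                      (subst (0 <_) (+-identityʳ _) au-followed)
  ... | b′ , aub′∈S = inj₂ (b′ , b≢b′ , <-≤-trans aub′∈S (occ-∷-≤ S (u ++ [ b′ ]) a))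
    where
    b≢b′ : b ≢ b′
    b≢b′ refl = <⇒≢ aub′∈S (sym aub∉S)

  middle-isMaximalRepeat : (S : String σ) (a : Fin σ) (u : String σ) (b : Fin σ) →
    occ S (a ∷ u ++ [ b ]) ≡ 0 → 0 < occ S (a ∷ u) → 0 < occ S (u ++ [ b ]) →
    T (isMaximalRepeat S u)
  middle-isMaximalRepeat S a u b aub∉S au∈S ub∈S =
    from T-∧ (<⇒<ᵇ repeated , from T-∧ (leftMaximal-u , rightMaximal-u))
    where
    repeated : 2 ≤ occ S u
    repeated = begin
      2                                                      ≤⟨ two-left-contexts left-context ⟩
      𝟙 (isPrefix u S) + ∑ (allFin σ) (λ a → occ S (a ∷ u))  ≡⟨ occ-left-extensions S u ⟨
      occ S u                                                ∎
      where
      open ≤-Reasoning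
      left-context = another-left-context S a u b aub∉S ub∈S
      two-left-contexts : T (isPrefix u S) ⊎ ∃[ a′ ] a ≢ a′ × 0 < occ S (a′ ∷ u) →
                          2 ≤ 𝟙 (isPrefix u S) + ∑ (allFin σ) (λ a → occ S (a ∷ u))
      two-left-contexts (inj₁ u-prefix) =
        +-mono-≤ (𝟙-mono {true} (λ _ → u-prefix))
                 (≤-trans au∈S (∑-∈ (λ a → occ S (a ∷ u)) (∈-allFin a)))
      two-left-contexts (inj₂ (a′ , a≢a′ , a′u∈S)) =
        ≤-trans (+-mono-≤ au∈S a′u∈S) (≤-trans (∑-allFin-pair (λ a → occ S (a ∷ u)) a≢a′) (m≤n+m _ _))

    leftMaximal-u : T (leftMaximal S u)
    leftMaximal-u with another-left-context S a u b aub∉S ub∈S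
    ... | inj₁ u-prefix = from T-∨ (inj₂ u-prefix)
    ... | inj₂ (a′ , a≢a′ , a′u∈S) =
      from T-∨ (inj₁ (any-distinct-pair (λ a → inSubstr S (a ∷ u)) a≢a′ (<⇒<ᵇ au∈S) (<⇒<ᵇ a′u∈S)))

    rightMaximal-u : T (rightMaximal S u)
    rightMaximal-u with another-right-context S a u b aub∉S au∈S
    ... | inj₁ (t , S≡tau) = from T-∨ (inj₂ (subst (T ∘ isSuffix u) S≡ta++u (isSuffix-++ (t ++ [ a ]) u)))
      where S≡ta++u = trans (++-assoc t [ a ] u) (sym S≡tau)
    ... | inj₂ (b′ , b≢b′ , ub′∈S) =
      from T-∨ (inj₁ (any-distinct-pair (λ b → inSubstr S (u ++ [ b ])) b≢b′
                                        (<⇒<ᵇ ub∈S) (<⇒<ᵇ ub′∈S)))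

  isMAW⇒isMaximalRepeat : (S : String σ) (a : Fin σ) (u : String σ) (b : Fin σ) →
    T (isMAW S a u b) → T (isMaximalRepeat S u)
  isMAW⇒isMaximalRepeat S a u b isMAW-aub with isMAW-occ S a u b isMAW-aub
  ... | aub∉S , au∈S , ub∈S = middle-isMaximalRepeat S a u b aub∉S au∈S ub∈S

  isMAW-≤-right : (S : String σ) (a : Fin σ) (u : String σ) (b : Fin σ) →
    𝟙 (isMAW S a u b) ≤ 𝟙 (isMaximalRepeat S u) * 𝟙 (inSubstr S (u ++ [ b ]))
  isMAW-≤-right S a u b = 𝟙-≤-* (λ isMAW-aub →
    isMAW⇒isMaximalRepeat S a u b isMAW-aub , <⇒<ᵇ (proj₂ (proj₂ (isMAW-occ S a u b isMAW-aub))))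

  isMAW-≤-left : (S : String σ) (a : Fin σ) (u : String σ) (b : Fin σ) →
    𝟙 (isMAW S a u b) ≤ 𝟙 (isMaximalRepeat S u) * 𝟙 (inSubstr S (a ∷ u))
  isMAW-≤-left S a u b = 𝟙-≤-* (λ isMAW-aub →
    isMAW⇒isMaximalRepeat S a u b isMAW-aub , <⇒<ᵇ (proj₁ (proj₂ (isMAW-occ S a u b isMAW-aub))))

  isMAW-or-occurs : (S : String σ) (a : Fin σ) (u : String σ) (b : Fin σ) →
    0 < occ S (a ∷ u) → 0 < occ S (u ++ [ b ]) → 1 ≤ 𝟙 (isMAW S a u b) + occ S (a ∷ u ++ [ b ])
  isMAW-or-occurs S a u b au∈S ub∈S
    with occ S (a ∷ u ++ [ b ]) | occ S (a ∷ u) | occ S (u ++ [ b ])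
  ... | zero  | suc _ | suc _ = ≤-refl
  ... | suc _ | _     | _     = s≤s z≤n

  MAWsWithMiddle : String σ → String σ → ℕ
  MAWsWithMiddle S u = ∑ (allFin σ) (λ a → ∑ (allFin σ) (λ b → 𝟙 (isMAW S a u b)))

  numMAW-by-middle : (S : String σ) → numMAW S ≡ ∑ (stringsUpTo (length S)) (MAWsWithMiddle S)
  numMAW-by-middle S = begin
    numMAW S
      ≡⟨ ∑-comm (allFin σ) (stringsUpTo (length S)) (λ a u → count (isMAW S a u) (allFin σ)) ⟩
    ∑ (stringsUpTo (length S)) (λ u → ∑ (allFin σ) (λ a → count (isMAW S a u) (allFin σ)))
      ≡⟨ ∑-cong (stringsUpTo (length S)) (λ u →
           ∑-cong (allFin σ) (λ a → count≡∑ (isMAW S a u) (allFin σ))) ⟩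
    ∑ (stringsUpTo (length S)) (MAWsWithMiddle S)
      ∎
    where open ≡-Reasoning

  numMAW-≤-σ*∑-maximalRepeats : (S : String σ) (f : String σ → ℕ) →
    (∀ u → MAWsWithMiddle S u ≤ σ * (𝟙 (isMaximalRepeat S u) * f u)) →
    numMAW S ≤ σ * ∑ (maximalRepeats S) f
  numMAW-≤-σ*∑-maximalRepeats S f MAWs≤ = begin
    numMAW S                                                    ≡⟨ numMAW-by-middle S ⟩
    ∑ U (MAWsWithMiddle S)                                      ≤⟨ ∑-mono-≤ U MAWs≤ ⟩
    ∑ U (λ u → σ * (𝟙 (isMaximalRepeat S u) * f u))             ≡⟨ ∑-*ˡ U σ _ ⟩
    σ * ∑ U (λ u → 𝟙 (isMaximalRepeat S u) * f u)               ≡⟨ cong (σ *_) (∑-maximalRepeats S f) ⟨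
    σ * ∑ (maximalRepeats S) f                                  ∎
    where
    open ≤-Reasoning
    U = stringsUpTo (length S)

  rightExtensions : String σ → String σ → ℕ
  rightExtensions S u = count (λ b → inSubstr S (u ++ [ b ])) (allFin σ)

  leftExtensions : String σ → String σ → ℕ
  leftExtensions S u = count (λ a → inSubstr S (a ∷ u)) (allFin σ)

  rightExtensions-≤ : (S u : String σ) → rightExtensions S u ≤ σ
  rightExtensions-≤ S u = ≤-trans (≤-reflexive (count≡∑ (λ b → inSubstr S (u ++ [ b ])) (allFin σ)))
                                  (∑-allFin-≤ _ (λ b → 𝟙≤1 (inSubstr S (u ++ [ b ]))))

  MAWsWithMiddle-≤-right : (S u : String σ) →
    MAWsWithMiddle S u ≤ σ * (𝟙 (isMaximalRepeat S u) * rightExtensions S u)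
  MAWsWithMiddle-≤-right S u = begin
    MAWsWithMiddle S u
      ≤⟨ ∑-mono-≤ (allFin σ) (λ a → ∑-mono-≤ (allFin σ) (isMAW-≤-right S a u)) ⟩
    ∑ (allFin σ) (λ _ → ∑ (allFin σ) (λ b → isMR * 𝟙 (inSubstr S (u ++ [ b ]))))
      ≡⟨ ∑-allFin-const σ _ ⟩
    σ * ∑ (allFin σ) (λ b → isMR * 𝟙 (inSubstr S (u ++ [ b ])))
      ≡⟨ cong (σ *_) (∑-*ˡ (allFin σ) isMR (λ b → 𝟙 (inSubstr S (u ++ [ b ])))) ⟩
    σ * (isMR * ∑ (allFin σ) (λ b → 𝟙 (inSubstr S (u ++ [ b ]))))
      ≡⟨ cong (λ n → σ * (isMR * n)) (count≡∑ (λ b → inSubstr S (u ++ [ b ])) (allFin σ)) ⟨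
    σ * (isMR * rightExtensions S u)
      ∎
    where
    open ≤-Reasoning
    isMR = 𝟙 (isMaximalRepeat S u)

  MAWsWithMiddle-≤-left : (S u : String σ) →
    MAWsWithMiddle S u ≤ σ * (𝟙 (isMaximalRepeat S u) * leftExtensions S u)
  MAWsWithMiddle-≤-left S u = begin
    MAWsWithMiddle S u
      ≤⟨ ∑-mono-≤ (allFin σ) (λ a → ∑-mono-≤ (allFin σ) (isMAW-≤-left S a u)) ⟩
    ∑ (allFin σ) (λ a → ∑ (allFin σ) (λ _ → isMR * 𝟙 (inSubstr S (a ∷ u))))
      ≡⟨ ∑-cong (allFin σ) (λ a → ∑-allFin-const σ _) ⟩
    ∑ (allFin σ) (λ a → σ * (isMR * 𝟙 (inSubstr S (a ∷ u))))
      ≡⟨ ∑-*ˡ (allFin σ) σ _ ⟩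
    σ * ∑ (allFin σ) (λ a → isMR * 𝟙 (inSubstr S (a ∷ u)))
      ≡⟨ cong (σ *_) (∑-*ˡ (allFin σ) isMR (λ a → 𝟙 (inSubstr S (a ∷ u)))) ⟩
    σ * (isMR * ∑ (allFin σ) (λ a → 𝟙 (inSubstr S (a ∷ u))))
      ≡⟨ cong (λ n → σ * (isMR * n)) (count≡∑ (λ a → inSubstr S (a ∷ u)) (allFin σ)) ⟨
    σ * (isMR * leftExtensions S u)
      ∎
    where
    open ≤-Reasoning
    isMR = 𝟙 (isMaximalRepeat S u)

  numMAW-≤-σ*eMin : (S : String σ) → numMAW S ≤ σ * eMin S
  numMAW-≤-σ*eMin S = begin
    numMAW S
      ≤⟨ ⊓-glb (numMAW-≤-σ*∑-maximalRepeats S (rightExtensions S) (MAWsWithMiddle-≤-right S))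
               (numMAW-≤-σ*∑-maximalRepeats S (leftExtensions S) (MAWsWithMiddle-≤-left S)) ⟩
    (σ * rOf S) ⊓ (σ * lOf S)
      ≡⟨ *-distribˡ-⊓ σ (rOf S) (lOf S) ⟨
    σ * eMin S
      ∎
    where open ≤-Reasoning

-- Minimal absent words of de Bruijn sequences

geometric-bound : ∀ {σ} → 2 ≤ σ → ∀ k → ∑ (upTo k) (λ j → σ ^ j * σ) + 2 ≤ 2 * σ ^ k
geometric-bound 2≤σ zero    = ≤-refl
geometric-bound {σ} 2≤σ (suc k) = begin
  ∑ (upTo (suc k)) h + 2         ≡⟨ cong (_+ 2) (∑-upTo-suc k h) ⟩
  ∑ (upTo k) h + σ ^ k * σ + 2   ≡⟨ +-swapʳ (∑ (upTo k) h) (σ ^ k * σ) 2 ⟩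
  ∑ (upTo k) h + 2 + σ ^ k * σ   ≤⟨ +-monoˡ-≤ (σ ^ k * σ) (geometric-bound 2≤σ k) ⟩
  2 * σ ^ k + σ ^ k * σ          ≤⟨ +-monoˡ-≤ (σ ^ k * σ) (*-monoˡ-≤ (σ ^ k) 2≤σ) ⟩
  σ * σ ^ k + σ ^ k * σ          ≡⟨ cong (σ * σ ^ k +_) (*-comm (σ ^ k) σ) ⟩
  σ * σ ^ k + σ * σ ^ k          ≡⟨ cong (σ * σ ^ k +_) (+-identityʳ (σ * σ ^ k)) ⟨
  2 * σ ^ suc k                  ∎
  where
  open ≤-Reasoning
  h = λ j → σ ^ j * σ

deBruijn-arithmetic : ∀ {σ P G M} → 2 ≤ σ → G + 2 ≤ 2 * P → P * σ ≤ M + suc P → σ * G ≤ 4 * M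
deBruijn-arithmetic {σ} {P} {G} {M} 2≤σ G+2≤2P Pσ≤M+1+P = +-cancelʳ-≤ R (σ * G) (4 * M) (begin
  σ * G + R
    ≡⟨ solve 3 (λ σ P G → σ :* G :+ (σ :* con 2 :+ con 4 :* P :+ con 4)
                        := σ :* (G :+ con 2) :+ (con 4 :* P :+ con 4)) refl σ P G ⟩
  σ * (G + 2) + (4 * P + 4)
    ≤⟨ +-mono-≤ (*-monoʳ-≤ σ G+2≤2P) (+-mono-≤ 4P≤σ2P 4≤σ2) ⟩
  σ * (2 * P) + (σ * (2 * P) + σ * 2)
    ≡⟨ solve 2 (λ σ P → σ :* (con 2 :* P) :+ (σ :* (con 2 :* P) :+ σ :* con 2)
                     := con 4 :* (P :* σ) :+ σ :* con 2) refl σ P ⟩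
  4 * (P * σ) + σ * 2
    ≤⟨ +-monoˡ-≤ (σ * 2) (*-monoʳ-≤ 4 Pσ≤M+1+P) ⟩
  4 * (M + suc P) + σ * 2
    ≡⟨ solve 3 (λ σ P M → con 4 :* (M :+ (con 1 :+ P)) :+ σ :* con 2
                       := con 4 :* M :+ (σ :* con 2 :+ con 4 :* P :+ con 4)) refl σ P M ⟩
  4 * M + R
    ∎)
  where
  open ≤-Reasoning
  open +-*-Solver
  R = σ * 2 + 4 * P + 4
  4P≤σ2P : 4 * P ≤ σ * (2 * P)
  4P≤σ2P = ≤-trans (≤-reflexive (*-assoc 2 2 P)) (*-monoˡ-≤ (2 * P) 2≤σ)
  4≤σ2 : 4 ≤ σ * 2
  4≤σ2 = *-monoˡ-≤ 2 2≤σ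

module DeBruijn {σ k′ : ℕ} (S : String σ) (deBruijn : IsDeBruijn (suc k′) S) where

  k = suc k′

  length-S : length S ≡ σ ^ k + k′
  length-S = trans (proj₁ deBruijn) (cong (_∸ 1) (+-suc (σ ^ k) k′))

  occ-≤1 : ∀ w → k ≤ length w → occ S w ≤ 1
  occ-≤1 w k≤|w| = begin
    occ S w                          ≡⟨ cong (occ S) (take++drop≡id k w) ⟨
    occ S (take k w ++ drop k w)     ≤⟨ occ-++-≤ S (take k w) (drop k w) ⟩
    occ S (take k w)                 ≡⟨ proj₂ deBruijn (take k w) |take-k-w|≡k ⟩
    1                                ∎
    where
    open ≤-Reasoning
    |take-k-w|≡k = trans (length-take k w) (m≤n⇒m⊓n≡m k≤|w|)

  maximalRepeat-short : ∀ u → T (isMaximalRepeat S u) → length u < k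
  maximalRepeat-short u isMR = ≰⇒> (λ k≤|u| → <⇒≱ 1<occ (occ-≤1 u k≤|u|))
    where 1<occ = <ᵇ⇒< 1 (occ S u) (proj₁ (to T-∧ isMR))

  maximalRepeat-weight-≤ : ∀ u → 𝟙 (isMaximalRepeat S u) * rightExtensions S u ≤ 𝟙 (length u <ᵇ k) * σ
  maximalRepeat-weight-≤ u with isMaximalRepeat S u in isMR
  ... | false = z≤n
  ... | true rewrite to T-≡ (<⇒<ᵇ (maximalRepeat-short u (subst T (sym isMR) _))) =
    +-monoˡ-≤ 0 (rightExtensions-≤ S u)

  rOf-≤ : rOf S ≤ ∑ (upTo k) (λ j → σ ^ j * σ)
  rOf-≤ = begin
    rOf S
      ≡⟨ ∑-maximalRepeats S (rightExtensions S) ⟩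
    ∑ (stringsUpTo (length S)) (λ u → 𝟙 (isMaximalRepeat S u) * rightExtensions S u)
      ≤⟨ ∑-mono-≤ (stringsUpTo (length S)) maximalRepeat-weight-≤ ⟩
    ∑ (stringsUpTo (length S)) (g ∘ length)
      ≡⟨ ∑-concatMap (upTo (suc (length S))) strings (g ∘ length) ⟩
    ∑ (upTo (suc (length S))) (λ j → ∑ (strings j) (g ∘ length))
      ≡⟨ ∑-cong (upTo (suc (length S))) (λ j →
           trans (∑-strings-length j g) (x∙yz≈y∙xz (σ ^ j) (𝟙 (j <ᵇ k)) σ)) ⟩
    ∑ (upTo (suc (length S))) (λ j → 𝟙 (j <ᵇ k) * (σ ^ j * σ))
      ≤⟨ ∑-upTo-below k (suc (length S)) (λ j → σ ^ j * σ) ⟩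
    ∑ (upTo k) (λ j → σ ^ j * σ)
      ∎
    where
    open ≤-Reasoning
    g = λ n → 𝟙 (n <ᵇ k) * σ

  triples-≤-MAWs+occ : ∀ u → length u ≡ k′ →
    σ * σ ≤ MAWsWithMiddle S u + ∑ (allFin σ) (λ a → ∑ (allFin σ) (λ b → occ S (a ∷ u ++ [ b ])))
  triples-≤-MAWs+occ u |u|≡k′ = begin
    σ * σ
      ≡⟨ cong (σ *_) (*-identityʳ σ) ⟨
    σ * (σ * 1)
      ≡⟨ trans (∑-cong (allFin σ) (λ _ → ∑-allFin-const σ 1)) (∑-allFin-const σ (σ * 1)) ⟨
    ∑ (allFin σ) (λ _ → ∑ (allFin σ) (λ _ → 1))
      ≤⟨ ∑-mono-≤ (allFin σ) (λ a → ∑-mono-≤ (allFin σ) (λ b →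
           isMAW-or-occurs S a u b (occurs (a ∷ u) (cong suc |u|≡k′)) (occurs (u ++ [ b ]) (|ub|≡k b)))) ⟩
    ∑ (allFin σ) (λ a → ∑ (allFin σ) (λ b → 𝟙 (isMAW S a u b) + occ S (a ∷ u ++ [ b ])))
      ≡⟨ ∑-cong (allFin σ) (λ a → ∑-+ (allFin σ) _ _) ⟩
    ∑ (allFin σ) (λ a → ∑ (allFin σ) (λ b → 𝟙 (isMAW S a u b))
                      + ∑ (allFin σ) (λ b → occ S (a ∷ u ++ [ b ])))
      ≡⟨ ∑-+ (allFin σ) _ _ ⟩
    MAWsWithMiddle S u + ∑ (allFin σ) (λ a → ∑ (allFin σ) (λ b → occ S (a ∷ u ++ [ b ])))
      ∎
    where
    open ≤-Reasoning
    occurs : ∀ w → length w ≡ k → 0 < occ S w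
    occurs w |w|≡k = ≤-reflexive (sym (proj₂ deBruijn w |w|≡k))
    |ub|≡k : ∀ b → length (u ++ [ b ]) ≡ k
    |ub|≡k b = trans (length-∷ʳ u b) (cong suc |u|≡k′)

  numMAW-≥ : σ ^ k * σ ≤ numMAW S + suc (σ ^ k)
  numMAW-≥ = begin
    σ * σ ^ k′ * σ
      ≡⟨ cong (_* σ) (*-comm σ (σ ^ k′)) ⟩
    σ ^ k′ * σ * σ
      ≡⟨ *-assoc (σ ^ k′) σ σ ⟩
    σ ^ k′ * (σ * σ)
      ≡⟨ ∑-strings-const k′ (σ * σ) ⟨
    ∑ (strings k′) (λ _ → σ * σ)
      ≤⟨ ∑-strings-mono-≤ k′ (λ u |u|≡k′ →
           ≤-trans (triples-≤-MAWs+occ u |u|≡k′) (+-monoʳ-≤ (MAWsWithMiddle S u) (∑-occ-two-sided-≤ S u))) ⟩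
    ∑ (strings k′) (λ u → MAWsWithMiddle S u + occ S u)
      ≡⟨ ∑-+ (strings k′) (MAWsWithMiddle S) (occ S) ⟩
    ∑ (strings k′) (MAWsWithMiddle S) + ∑ (strings k′) (occ S)
      ≤⟨ +-mono-≤ windows≤numMAW (≤-reflexive windows) ⟩
    numMAW S + suc (σ ^ k)
      ∎
    where
    open ≤-Reasoning
    windows : ∑ (strings k′) (occ S) ≡ suc (σ ^ k)
    windows = trans (∑-strings-occ k′ S)
                    (trans (cong (λ n → suc n ∸ k′) length-S) (m+n∸n≡m (suc (σ ^ k)) k′))
    windows≤numMAW : ∑ (strings k′) (MAWsWithMiddle S) ≤ numMAW S
    windows≤numMAW = begin
      ∑ (strings k′) (MAWsWithMiddle S)
        ≤⟨ ∑-∈ (λ j → ∑ (strings j) (MAWsWithMiddle S)) (∈-upTo⁺ (s≤s k′≤|S|)) ⟩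
      ∑ (upTo (suc (length S))) (λ j → ∑ (strings j) (MAWsWithMiddle S))
        ≡⟨ ∑-concatMap (upTo (suc (length S))) strings (MAWsWithMiddle S) ⟨
      ∑ (stringsUpTo (length S)) (MAWsWithMiddle S)
        ≡⟨ numMAW-by-middle S ⟨
      numMAW S
        ∎
      where k′≤|S| = ≤-trans (m≤n+m k′ (σ ^ k)) (≤-reflexive (sym length-S))

  σ*eMin-≤-4*numMAW : 2 ≤ σ → σ * eMin S ≤ 4 * numMAW S
  σ*eMin-≤-4*numMAW 2≤σ = ≤-trans (*-monoʳ-≤ σ (≤-trans (m⊓n≤m (rOf S) (lOf S)) rOf-≤))
                                  (deBruijn-arithmetic 2≤σ (geometric-bound 2≤σ k) numMAW-≥)

-- Existence of de Bruijn sequences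

module Greedy (m k′ : ℕ) where

  σ = suc m
  k = suc k′

  zeros : String σ
  zeros = replicate k′ zero

  -- x is the sequence built so far, v its last k′ letters, and n letters remain to be appended.
  record Invariant (x v : String σ) (n : ℕ) : Set where
    field
      suffix       : ∃[ t ] x ≡ t ++ v
      window       : length v ≡ k′
      zeros-prefix : T (isPrefix zeros x)
      once         : ∀ w → length w ≡ k → occ x w ≤ 1
      zero-last    : ∀ u → length u ≡ k′ → 0 < occ x (u ++ [ zero ]) →
                     ∀ c → 0 < occ x (u ++ [ c ])
      budget       : length x + n ≡ σ ^ k + k′

  module _ {x v n} (I : Invariant x v (suc n)) (c : Fin σ) (vc∉x : occ x (v ++ [ c ]) ≡ 0)
           (forced : c ≡ zero → ∀ c′ → c′ ≢ zero → 0 < occ x (v ++ [ c′ ])) where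
    open Invariant I

    private
      t = proj₁ suffix

      |vc|≡k : length (v ++ [ c ]) ≡ k
      |vc|≡k = trans (length-∷ʳ v c) (cong suc window)

      x++c≡t++vc : x ++ [ c ] ≡ t ++ (v ++ [ c ])
      x++c≡t++vc = trans (cong (_++ [ c ]) (proj₂ suffix)) (++-assoc t v [ c ])

      occ-append : ∀ w → length w ≡ k → occ (x ++ [ c ]) w ≡ occ x w + 𝟙 (w ==ˢ v ++ [ c ])
      occ-append w |w|≡k = begin
        occ (x ++ [ c ]) w                     ≡⟨ occ-∷ʳ x w c ⟩
        occ x w + occAtEnd (x ++ [ c ]) w      ≡⟨ cong (λ y → occ x w + occAtEnd y w) x++c≡t++vc ⟩
        occ x w + occAtEnd (t ++ v ++ [ c ]) w ≡⟨ cong (occ x w +_) (occAtEnd-++ t (v ++ [ c ]) w |w|≡|vc|) ⟩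
        occ x w + 𝟙 (w ==ˢ v ++ [ c ])         ∎
        where
        open ≡-Reasoning
        |w|≡|vc| = trans |w|≡k (sym |vc|≡k)

      occ-grows : ∀ w → occ x w ≤ occ (x ++ [ c ]) w
      occ-grows w = ≤-trans (m≤m+n _ _) (≤-reflexive (sym (occ-∷ʳ x w c)))

      once′ : ∀ w → length w ≡ k → occ (x ++ [ c ]) w ≤ 1
      once′ w |w|≡k with w ==ˢ v ++ [ c ] in w≟vc
      ... | true  = ≤-reflexive (begin
        occ (x ++ [ c ]) w              ≡⟨ occ-append w |w|≡k ⟩
        occ x w + 𝟙 (w ==ˢ v ++ [ c ])  ≡⟨ cong₂ _+_ (trans (cong (occ x) w≡vc) vc∉x) (cong 𝟙 w≟vc) ⟩
        1                               ∎)
        where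
        open ≡-Reasoning
        w≡vc = ==ˢ-sound w (v ++ [ c ]) (subst T (sym w≟vc) _)
      ... | false = begin
        occ (x ++ [ c ]) w              ≡⟨ occ-append w |w|≡k ⟩
        occ x w + 𝟙 (w ==ˢ v ++ [ c ])  ≡⟨ cong (λ b → occ x w + 𝟙 b) w≟vc ⟩
        occ x w + 0                     ≡⟨ +-identityʳ (occ x w) ⟩
        occ x w                         ≤⟨ once w |w|≡k ⟩
        1                               ∎
        where open ≤-Reasoning

      zero-last′ : ∀ u → length u ≡ k′ → 0 < occ (x ++ [ c ]) (u ++ [ zero ]) →
                   ∀ c″ → 0 < occ (x ++ [ c ]) (u ++ [ c″ ])
      zero-last′ u |u|≡k′ u0∈x′ c″ with occ x (u ++ [ zero ]) in u0≡
      ... | suc _ = ≤-trans (zero-last u |u|≡k′ (subst (0 <_) (sym u0≡) z<s) c″) (occ-grows (u ++ [ c″ ]))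
      ... | zero with u ++ [ zero ] ==ˢ v ++ [ c ] in u0≟vc
      ...   | false = ⊥-elim (<-irrefl (sym u0∉x′) u0∈x′)
        where
        u0∉x′ : occ (x ++ [ c ]) (u ++ [ zero ]) ≡ 0
        u0∉x′ = trans (occ-append (u ++ [ zero ]) (trans (length-∷ʳ u zero) (cong suc |u|≡k′)))
                      (cong₂ _+_ u0≡ (cong 𝟙 u0≟vc))
      ...   | true with ∷ʳ-injective u v (==ˢ-sound (u ++ [ zero ]) (v ++ [ c ]) (subst T (sym u0≟vc) _))
      ...     | refl , 0≡c with c″ ≟ zero
      ...       | yes refl = u0∈x′
      ...       | no  c″≢0 = ≤-trans (forced (sym 0≡c) c″ c″≢0) (occ-grows (u ++ [ c″ ]))

    append : Invariant (x ++ [ c ]) (drop 1 (v ++ [ c ])) n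
    append = record
      { suffix       = t ++ take 1 (v ++ [ c ])
                     , trans x++c≡t++vc (trans (cong (t ++_) (sym (take++drop≡id 1 (v ++ [ c ]))))
                                               (sym (++-assoc t (take 1 (v ++ [ c ])) _)))
      ; window       = trans (length-drop 1 (v ++ [ c ])) (cong (_∸ 1) |vc|≡k)
      ; zeros-prefix = isPrefix-++⁺ zeros x [ c ] zeros-prefix
      ; once         = once′
      ; zero-last    = zero-last′
      ; budget       = trans (cong (_+ n) (length-∷ʳ x c)) (trans (sym (+-suc (length x) n)) budget)
      }

  module _ {x v n} (I : Invariant x v (suc n)) (full : ∀ c → 0 < occ x (v ++ [ c ])) where
    open Invariant I

    private
      inflow outflow : String σ → ℕ
      inflow  u = ∑ (allFin σ) (λ a → occ x (a ∷ u))
      outflow u = ∑ (allFin σ) (λ c → occ x (u ++ [ c ]))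

      Missing : String σ → Set
      Missing u = ∃[ c ] occ x (u ++ [ c ]) ≡ 0

      occAtEnd-x : ∀ u → length u ≡ k′ → occAtEnd x u ≡ 𝟙 (u ==ˢ v)
      occAtEnd-x u |u|≡k′ = trans (cong (λ y → occAtEnd y u) (proj₂ suffix))
                                 (occAtEnd-++ (proj₁ suffix) v u (trans |u|≡k′ (sym window)))

      once-∷ : ∀ a u → length u ≡ k′ → occ x (a ∷ u) ≤ 1
      once-∷ a u |u|≡k′ = once (a ∷ u) (cong suc |u|≡k′)

      v-prefix : T (isPrefix v x)
      v-prefix with isPrefix v x in v⊑x
      ... | true  = _
      ... | false = ⊥-elim (<-irrefl refl (begin-strict
        σ                         <⟨ m<m+n σ z<s ⟩
        σ + 1                     ≡⟨ cong₂ _+_ (sym outflow-v) (cong 𝟙 (sym (to T-≡ (==ˢ-refl v)))) ⟩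
        outflow v + 𝟙 (v ==ˢ v)   ≡⟨ cong (outflow v +_) (occAtEnd-x v window) ⟨
        outflow v + occAtEnd x v  ≡⟨ occ-right-extensions x v ⟨
        occ x v                   ≡⟨ occ-left-extensions x v ⟩
        𝟙 (isPrefix v x) + inflow v ≡⟨ cong (λ b → 𝟙 b + inflow v) v⊑x ⟩
        inflow v                  ≤⟨ ∑-allFin-≤ (λ a → occ x (a ∷ v)) (λ a → once-∷ a v window) ⟩
        σ                         ∎))
        where
        open ≤-Reasoning
        outflow-v : outflow v ≡ σ
        outflow-v = ≤-antisym
          (∑-allFin-≤ _ (λ c → once (v ++ [ c ]) (trans (length-∷ʳ v c) (cong suc window))))
          (∑-allFin-≥ _ full)

      v≡zeros : v ≡ zeros
      v≡zeros = isPrefix-unique v zeros x v-prefix zeros-prefix (trans window (sym (length-replicate k′)))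

      balance : ∀ u → length u ≡ k′ → inflow u ≡ outflow u
      balance u |u|≡k′ = +-cancelʳ-≡ (𝟙 (u ==ˢ v)) (inflow u) (outflow u) (begin
        inflow u + 𝟙 (u ==ˢ v)          ≡⟨ cong (inflow u +_) starts≡ends ⟨
        inflow u + 𝟙 (isPrefix u x)     ≡⟨ +-comm (inflow u) _ ⟩
        𝟙 (isPrefix u x) + inflow u     ≡⟨ occ-left-extensions x u ⟨
        occ x u                         ≡⟨ occ-right-extensions x u ⟩
        outflow u + occAtEnd x u        ≡⟨ cong (outflow u +_) (occAtEnd-x u |u|≡k′) ⟩
        outflow u + 𝟙 (u ==ˢ v)         ∎)
        where
        open ≡-Reasoning
        starts⇒ends : T (isPrefix u x) → T (u ==ˢ v)
        starts⇒ends u⊑x =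
          subst (λ y → T (u ==ˢ y)) (isPrefix-unique u v x u⊑x v-prefix (trans |u|≡k′ (sym window))) (==ˢ-refl u)
        ends⇒starts : T (u ==ˢ v) → T (isPrefix u x)
        ends⇒starts u≟v = subst (λ y → T (isPrefix y x)) (sym (==ˢ-sound u v u≟v)) v-prefix
        starts≡ends : 𝟙 (isPrefix u x) ≡ 𝟙 (u ==ˢ v)
        starts≡ends = ≤-antisym (𝟙-mono starts⇒ends) (𝟙-mono ends⇒starts)

      missing-slides : ∀ a w → length (a ∷ w) ≡ k′ → Missing (a ∷ w) → Missing (w ++ [ zero ])
      missing-slides a w |aw|≡k′ (c , awc∉x) =
        ∑-allFin-<⇒zero (λ c → occ x ((w ++ [ zero ]) ++ [ c ])) (begin-strict
          outflow (w ++ [ zero ])   ≡⟨ balance (w ++ [ zero ]) |w0|≡k′ ⟨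
          inflow (w ++ [ zero ])    <⟨ ∑-allFin-< _ (λ b → once-∷ b (w ++ [ zero ]) |w0|≡k′) a aw0∉x ⟩
          σ                         ∎)
        where
        open ≤-Reasoning
        |w0|≡k′ : length (w ++ [ zero ]) ≡ k′
        |w0|≡k′ = trans (length-∷ʳ w zero) |aw|≡k′
        aw0∉x : occ x (a ∷ w ++ [ zero ]) ≡ 0
        aw0∉x = n≤0⇒n≡0 (≮⇒≥ λ aw0∈x → <-irrefl (sym awc∉x) (zero-last (a ∷ w) |aw|≡k′ aw0∈x c))

      missing-reaches-zeros : ∀ p j → length p + j ≡ k′ →
        Missing (p ++ replicate j zero) → Missing (replicate (length p + j) zero)
      missing-reaches-zeros []      j _        missing = missing
      missing-reaches-zeros (a ∷ p) j |apj|≡k′ missing =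
        subst (λ n → Missing (replicate n zero)) (+-suc (length p) j)
          (missing-reaches-zeros p (suc j) (trans (+-suc (length p) j) |apj|≡k′)
            (subst Missing slid (missing-slides a (p ++ replicate j zero) |ap0ʲ|≡k′ missing)))
        where
        slid : (p ++ replicate j zero) ++ [ zero ] ≡ p ++ replicate (suc j) zero
        slid = trans (++-assoc p (replicate j zero) [ zero ]) (cong (p ++_) (replicate-∷ʳ j zero))
        |ap0ʲ|≡k′ : length (a ∷ p ++ replicate j zero) ≡ k′
        |ap0ʲ|≡k′ = trans (cong suc (trans (length-++ p) (cong (length p +_) (length-replicate j)))) |apj|≡k′

      all-windows : ∀ w → length w ≡ k → 0 < occ x w
      all-windows w |w|≡k with initLast w
      ... | []      = ⊥-elim (0≢1+n |w|≡k)
      ... | u ∷ʳ′ c = n≢0⇒n>0 (λ uc∉x → v-complete (subst Missing u0≡v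
                        (missing-reaches-zeros u 0 |u|+0≡k′ (subst Missing (sym (++-identityʳ u)) (c , uc∉x)))))
        where
        |u|+0≡k′ : length u + 0 ≡ k′
        |u|+0≡k′ = trans (+-identityʳ (length u)) (suc-injective (trans (sym (length-∷ʳ u c)) |w|≡k))
        u0≡v : replicate (length u + 0) zero ≡ v
        u0≡v = trans (cong (λ n → replicate n zero) |u|+0≡k′) (sym v≡zeros)
        v-complete : ¬ Missing v
        v-complete (c′ , vc′∉x) = <-irrefl (sym vc′∉x) (full c′)

    dead-end : ⊥
    dead-end = <-irrefl refl (begin-strict
      σ ^ k + k′           ≤⟨ +-monoˡ-≤ k′ all-windows-counted ⟩
      length x ∸ k′ + k′   ≡⟨ m∸n+n≡m k′≤|x| ⟩
      length x             <⟨ m<m+n (length x) z<s ⟩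
      length x + suc n     ≡⟨ budget ⟩
      σ ^ k + k′           ∎)
      where
      open ≤-Reasoning
      all-windows-counted : σ ^ k ≤ length x ∸ k′
      all-windows-counted = begin
        σ ^ k                    ≡⟨ trans (∑-strings-const k 1) (*-identityʳ (σ ^ k)) ⟨
        ∑ (strings k) (λ _ → 1)  ≤⟨ ∑-strings-mono-≤ k all-windows ⟩
        ∑ (strings k) (occ x)    ≡⟨ ∑-strings-occ k x ⟩
        length x ∸ k′            ∎
      k′≤|x| : k′ ≤ length x
      k′≤|x| = begin
        k′                           ≡⟨ window ⟨
        length v                     ≤⟨ m≤n+m (length v) (length t) ⟩
        length t + length v          ≡⟨ length-++ t ⟨
        length (t ++ v)              ≡⟨ cong length (proj₂ suffix) ⟨
        length x                     ∎
        where t = proj₁ suffix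

  start : Invariant zeros zeros (σ ^ k)
  start = record
    { suffix       = [] , refl
    ; window       = length-replicate k′
    ; zeros-prefix = isPrefix-refl zeros
    ; once         = λ w |w|≡k → subst (_≤ 1) (sym (windows-absent w |w|≡k)) z≤n
    ; zero-last    = λ u |u|≡k′ u0∈zeros →
                       ⊥-elim (<-irrefl (sym (windows-absent (u ++ [ zero ]) (|u0|≡k u |u|≡k′))) u0∈zeros)
    ; budget       = trans (cong (_+ σ ^ k) (length-replicate k′)) (+-comm k′ (σ ^ k))
    }
    where
    windows-absent : ∀ w → length w ≡ k → occ zeros w ≡ 0
    windows-absent w |w|≡k = occ-long zeros w (subst₂ _<_ (sym (length-replicate k′)) (sym |w|≡k) (n<1+n k′))
    |u0|≡k : ∀ u → length u ≡ k′ → length (u ++ [ zero ]) ≡ k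
    |u0|≡k u |u|≡k′ = trans (length-∷ʳ u zero) (cong suc |u|≡k′)

  complete : ∀ {x v} → Invariant x v 0 → IsDeBruijn k x
  complete {x} I = |x|≡σ^k+k∸1 , ∑-strings-≤1-exact k (occ x) once (≤-reflexive (sym all-windows-counted))
    where
    open Invariant I
    |x|≡σ^k+k′ : length x ≡ σ ^ k + k′
    |x|≡σ^k+k′ = trans (sym (+-identityʳ (length x))) budget
    |x|≡σ^k+k∸1 : length x ≡ σ ^ k + k ∸ 1
    |x|≡σ^k+k∸1 = trans |x|≡σ^k+k′ (cong (_∸ 1) (sym (+-suc (σ ^ k) k′)))
    all-windows-counted : ∑ (strings k) (occ x) ≡ σ ^ k
    all-windows-counted =
      trans (∑-strings-occ k x) (trans (cong (_∸ k′) |x|≡σ^k+k′) (m+n∸n≡m (σ ^ k) k′))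

  run : ∀ n {x v} → Invariant x v n → Σ (String σ) (IsDeBruijn k)
  run zero    {x}     I = x , complete I
  run (suc n) {x} {v} I with any? (λ c → ¬? (c ≟ zero) ×-dec (occ x (v ++ [ c ]) ≟ℕ 0))
  ... | yes (c , c≢0 , vc∉x) = run n (append I c vc∉x (⊥-elim ∘ c≢0))
  ... | no  no-nonzero = step (occ x (v ++ [ zero ]) ≟ℕ 0)
    where
    nonzero-present : ∀ c → c ≢ zero → 0 < occ x (v ++ [ c ])
    nonzero-present c c≢0 = n≢0⇒n>0 (λ vc∉x → no-nonzero (c , c≢0 , vc∉x))
    full : 0 < occ x (v ++ [ zero ]) → ∀ c → 0 < occ x (v ++ [ c ])
    full v0∈x c with c ≟ zero
    ... | yes refl = v0∈x
    ... | no  c≢0  = nonzero-present c c≢0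
    step : Dec (occ x (v ++ [ zero ]) ≡ 0) → Σ (String σ) (IsDeBruijn k)
    step (yes v0∉x) = run n (append I zero v0∉x (λ _ → nonzero-present))
    step (no  v0∈x) = ⊥-elim (dead-end I (full (n≢0⇒n>0 v0∈x)))

deBruijn-exists : ∀ m k′ → Σ (String (suc m)) (IsDeBruijn (suc k′))
deBruijn-exists m k′ = Greedy.run m k′ _ (Greedy.start m k′)

theorem2 :
  -- upper bound: |MAW(S)| = O(σ · e_min(S)), uniformly in σ and S
  Σ ℕ (λ C → (σ : ℕ) (S : List (Fin σ)) → numMAW S ≤ C * (σ * eMin S))
  ×
  -- tightness: for every σ ≥ 2 and every order k ≥ 1 there is a de Bruijn
  -- sequence S of order k over Fin σ, and all of them satisfy
  -- |MAW(S)| = Ω(σ · e_min(S)) with one uniform constant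
  Σ ℕ (λ D →
    (σ k : ℕ) → 2 ≤ σ → 1 ≤ k →
      Σ (List (Fin σ)) (λ S → IsDeBruijn k S)
      × ((S : List (Fin σ)) → IsDeBruijn k S → σ * eMin S ≤ D * numMAW S))
theorem2 = (1 , upper) , (4 , lower)
  where
  upper : (σ : ℕ) (S : List (Fin σ)) → numMAW S ≤ 1 * (σ * eMin S)
  upper σ S = ≤-trans (numMAW-≤-σ*eMin S) (≤-reflexive (sym (*-identityˡ (σ * eMin S))))

  lower : (σ k : ℕ) → 2 ≤ σ → 1 ≤ k →
          Σ (List (Fin σ)) (λ S → IsDeBruijn k S)
          × ((S : List (Fin σ)) → IsDeBruijn k S → σ * eMin S ≤ 4 * numMAW S)
  lower (suc m) (suc k′) 2≤σ _ =
    deBruijn-exists m k′ , λ S isDeBruijn → DeBruijn.σ*eMin-≤-4*numMAW S isDeBruijn 2≤σ
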